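{- Let $n\ge 3$. If $n$ is even, then $\mathcal P_{n+1}\cong\mathbf 2\times\mathcal P_n$ as posets. If $n$ is odd, then $\mathcal P_{n+1}\cong(\mathbf 2\times\mathcal P_n)\setminus(\{2\}\times\mathcal P_{n,\lfloor\frac{n-1}{2}\rfloor-1})$, where the right-hand side is the induced subposet of $\mathbf 2\times\mathcal P_n$ on the indicated set.
   Context: $[n]=\{1,\dots,n\}$; $\mathfrak S_n$ is the set of permutations of $[n]$ in one-line notation. The circular peak set of $\sigma\in\mathfrak S_n$ is $CP(\sigma)=\{\sigma(i)\mid 2\le i\le n-1,\ \sigma(i-1)<\sigma(i)>\sigma(i+1)\}$; for $S\subseteq[n]$, $CP_n(S)=\{\sigma\in\mathfrak S_n\mid CP(\sigma)=S\}$, and $\mathcal P_n=\{S\subseteq[n]\mid CP_n(S)\neq\emptyset\}$, a poset under inclusion. $\mathcal P_{n,i}=\{S\in\mathcal P_n\mid |S|=i+1\}$. $\mathbf 2$ is the poset $\{1,2\}$ with $1<2$, and for posets $P,Q$ the direct product $P\times Q$ has $(x,y)\le(x',y')$ iff $x\le x'$ in $P$ and $y\le y'$ in $Q$. -}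

module Defs where

open import Data.Nat as ℕ using (ℕ; suc; _∸_; _+_; ⌊_/2⌋)
open import Data.Fin as Fin using (Fin; toℕ)
open import Data.Fin.Subset using (Subset; _∈_; _⊆_; ∣_∣)
open import Data.Fin.Permutation using (Permutation′; _⟨$⟩ʳ_)
open import Data.Bool using (Bool; true; false)
import Data.Bool as B
open import Data.Product using (Σ; ∃; ∃-syntax; _×_; _,_; proj₁; proj₂)
open import Relation.Binary.PropositionalEquality using (_≡_)
open import Relation.Nullary using (¬_)
open import Function.Bundles using (_⇔_)

-- Convention: the value set [n] = {1,…,n} is encoded as Fin n (value k+1 ↦ index k);
-- positions 1,…,n likewise as Fin n.  Both encodings are order-preserving.

IsPeakValue : {n : ℕ} → Permutation′ n → Fin n → Set
IsPeakValue {n} σ v =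
  Σ (Fin n) λ a → Σ (Fin n) λ b → Σ (Fin n) λ c →
    (toℕ b ≡ suc (toℕ a)) × (toℕ c ≡ suc (toℕ b)) ×
    ((σ ⟨$⟩ʳ a) Fin.< (σ ⟨$⟩ʳ b)) × ((σ ⟨$⟩ʳ c) Fin.< (σ ⟨$⟩ʳ b)) ×
    (σ ⟨$⟩ʳ b ≡ v)

CPIs : {n : ℕ} → Permutation′ n → Subset n → Set
CPIs {n} σ S = ∀ (v : Fin n) → (v ∈ S) ⇔ IsPeakValue σ v

P : ℕ → Set
P n = Σ (Subset n) λ S → ∃[ σ ] CPIs σ S

_≤P_ : {n : ℕ} → P n → P n → Set
x ≤P y = proj₁ x ⊆ proj₁ y

_≈P_ : {n : ℕ} → P n → P n → Set
x ≈P y = proj₁ x ≡ proj₁ y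

-- membership in 𝒫_{n,i}:  |S| = i + 1
InPni : {n : ℕ} → ℕ → P n → Set
InPni i x = ∣ proj₁ x ∣ ≡ i + 1

-- the poset 2 = {1 < 2}, encoded as Bool with 1 ↦ false, 2 ↦ true, order B._≤_ (false ≤ true)
-- direct product 2 × 𝒫_n
TwoP : ℕ → Set
TwoP n = Bool × P n

_≤2P_ : {n : ℕ} → TwoP n → TwoP n → Set
(b , x) ≤2P (c , y) = (b B.≤ c) × (x ≤P y)

_≈2P_ : {n : ℕ} → TwoP n → TwoP n → Set
(b , x) ≈2P (c , y) = (b ≡ c) × (x ≈P y)

TwoPMinus : ℕ → ℕ → Set
TwoPMinus n i = Σ (TwoP n) λ p → ¬ ((proj₁ p ≡ true) × InPni i (proj₂ p))

_≤2PM_ : {n i : ℕ} → TwoPMinus n i → TwoPMinus n i → Set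
p ≤2PM q = proj₁ p ≤2P proj₁ q

_≈2PM_ : {n i : ℕ} → TwoPMinus n i → TwoPMinus n i → Set
p ≈2PM q = proj₁ p ≈2P proj₁ q

record PosetIso {A B : Set}
                (_≈A_ _≤A_ : A → A → Set) (_≈B_ _≤B_ : B → B → Set) : Set where
  field
    to       : A → B
    from     : B → A
    from-to  : ∀ x → from (to x) ≈A x
    to-from  : ∀ y → to (from y) ≈B y
    order    : ∀ x y → (x ≤A y) ⇔ (to x ≤B to y)

removedRank : ℕ → ℕ
removedRank n = ⌊ n ∸ 1 /2⌋ ∸ 1

-- Positions and values are counted from 0.  A set S ⊆ {0,…,m-1} is the peak value set of a permutation
-- of length m iff 2·#{x ∈ S ∣ x ≤ v} ≤ v for every v ∈ S.  Necessity: deleting the largest value keeps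
-- every other peak value, and the peaks of a sequence sit at pairwise non-adjacent interior positions,
-- so there are at most ⌊(m-1)/2⌋ of them.  Sufficiency, by induction on m: insert the new largest value
-- m-1 at the end when m-1 ∉ S, and otherwise between two adjacent non-peak positions (which exist by the
-- counting condition), creating the single new peak m-1 and destroying none.
-- Consequently T ∪ {n+1} ∈ 𝒫_{n+1} iff T ∈ 𝒫_n and 2(|T|+1) ≤ n, whereas T ∈ 𝒫_n alone forces
-- 2|T| ≤ n-1: the extra condition is automatic for n even and, for n odd, fails exactly when |T| = (n-1)/2.

module Submission where

open import Defs
open import Data.Nat using (ℕ; suc; _≤_)
open import Data.Nat.Divisibility using (_∣_)
open import Data.Product using (_×_)
open import Relation.Nullary using (¬_)

open import Data.Nat.Base using (zero; pred; _∸_; ⌊_/2⌋; _+_; _*_; _<_; z≤n; s≤s; s≤s⁻¹; s<s⁻¹; s<s; z<s)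
open import Data.Nat.Properties
open import Data.Nat.Divisibility using (divides; _∣0; ∣-refl; ∣m∣n⇒∣m+n)
open import Data.Fin.Base using (Fin; toℕ; fromℕ<; fromℕ; punchIn)
open import Data.Fin.Properties using (toℕ<n; toℕ-fromℕ; toℕ-fromℕ<; fromℕ<-toℕ; toℕ-injective)
import Data.Fin.Base as Fin
import Data.Fin.Properties as Fin
import Algebra.Properties.CommutativeMonoid.Sum +-0-commutativeMonoid as Σ
open import Data.Fin.Permutation
  using (Permutation′; id; _⟨$⟩ʳ_; _⟨$⟩ˡ_; inverseˡ; inverseʳ; insert; remove; insert-punchIn; punchIn-permute′)
open import Data.Bool.Base using (Bool; true; false)
import Data.Bool.Base as B
import Data.Bool.Properties as B
open import Data.Vec.Base using (_∷_; []; _∷ʳ_; init; last; initLast; lookup; here)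
open import Data.Vec.Properties using ([]=⇒lookup; lookup⇒[]=; init-∷ʳ; last-∷ʳ)
open import Data.Fin.Subset using (Subset; _∈_; _⊆_; ∣_∣)
open import Data.Fin.Subset.Properties using (drop-∷-⊆; s⊆s; out⊆)
open import Data.Product using (Σ; Σ-syntax; ∃-syntax; _,_; proj₁; proj₂; uncurry)
open import Data.Sum using (_⊎_; inj₁; inj₂)
open import Data.Empty using (⊥)
open import Relation.Nullary using (Dec; yes; no; ¬?; contradiction)
open import Relation.Nullary.Decidable using (_×-dec_; map′)
open import Relation.Unary using (Decidable)
open import Function.Bundles using (_⇔_; mk⇔; Equivalence)
open import Function.Construct.Composition using (_⇔-∘_)
open import Function.Construct.Symmetry using (⇔-sym)
open import Function.Construct.Identity using (⇔-id)
open import Data.Product.Function.NonDependent.Propositional using (_×-⇔_)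
open import Relation.Binary.Definitions using (tri<; tri≈; tri>)
open import Relation.Binary.PropositionalEquality
  using (_≡_; _≢_; refl; sym; trans; cong; cong₂; subst; subst₂; module ≡-Reasoning)

-- Permutations as sequences, and their peaks

entry : ∀ {m} → Permutation′ m → ℕ → ℕ
entry {m} σ k with k <? m
... | yes k<m = toℕ (σ ⟨$⟩ʳ fromℕ< k<m)
... | no  _   = 0

entry-fromℕ< : ∀ {m} (σ : Permutation′ m) {k} (k<m : k < m) → entry σ k ≡ toℕ (σ ⟨$⟩ʳ fromℕ< k<m)
entry-fromℕ< {m} σ {k} k<m with k <? m
... | yes _   = refl
... | no  k≮m = contradiction k<m k≮m

entry-toℕ : ∀ {m} (σ : Permutation′ m) (i : Fin m) → entry σ (toℕ i) ≡ toℕ (σ ⟨$⟩ʳ i)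
entry-toℕ σ i = trans (entry-fromℕ< σ (toℕ<n i)) (cong (λ j → toℕ (σ ⟨$⟩ʳ j)) (fromℕ<-toℕ i _))

entry< : ∀ {m} (σ : Permutation′ m) {k} → k < m → entry σ k < m
entry< σ k<m = subst (_< _) (sym (entry-fromℕ< σ k<m)) (toℕ<n _)

entry-injective : ∀ {m} (σ : Permutation′ m) {k l} → k < m → l < m → entry σ k ≡ entry σ l → k ≡ l
entry-injective σ {k} {l} k<m l<m e = begin
  k                  ≡⟨ toℕ-fromℕ< k<m ⟨
  toℕ (fromℕ< k<m)   ≡⟨ cong toℕ (permutation-injective σ-equal) ⟩
  toℕ (fromℕ< l<m)   ≡⟨ toℕ-fromℕ< l<m ⟩
  l                  ∎
  where
  open ≡-Reasoning
  σ-equal : σ ⟨$⟩ʳ fromℕ< k<m ≡ σ ⟨$⟩ʳ fromℕ< l<m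
  σ-equal = toℕ-injective (trans (sym (entry-fromℕ< σ k<m)) (trans e (entry-fromℕ< σ l<m)))
  permutation-injective : ∀ {i j} → σ ⟨$⟩ʳ i ≡ σ ⟨$⟩ʳ j → i ≡ j
  permutation-injective eq = trans (sym (inverseˡ σ)) (trans (cong (σ ⟨$⟩ˡ_) eq) (inverseˡ σ))

entry-max : ∀ {n} (σ : Permutation′ (suc n)) {i} → σ ⟨$⟩ʳ i ≡ fromℕ n → entry σ (toℕ i) ≡ n
entry-max {n} σ {i} σi≡n = trans (entry-toℕ σ i) (trans (cong toℕ σi≡n) (toℕ-fromℕ n))

PeakAfter : (ℕ → ℕ) → ℕ → ℕ → Set
PeakAfter f m j = suc (suc j) < m × f j < f (suc j) × f (suc (suc j)) < f (suc j)

PeakAt : (ℕ → ℕ) → ℕ → ℕ → Set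
PeakAt f m zero    = ⊥
PeakAt f m (suc j) = PeakAfter f m j

PeakValue : (ℕ → ℕ) → ℕ → ℕ → Set
PeakValue f m w = ∃[ j ] PeakAfter f m j × f (suc j) ≡ w

peakAfter? : ∀ f m j → Dec (PeakAfter f m j)
peakAfter? f m j = (suc (suc j) <? m) ×-dec (f j <? f (suc j)) ×-dec (f (suc (suc j)) <? f (suc j))

peakAt? : ∀ f m k → Dec (PeakAt f m k)
peakAt? f m zero    = no λ ()
peakAt? f m (suc j) = peakAfter? f m j

peakValue? : ∀ f m w → Dec (PeakValue f m w)
peakValue? f m w =
  map′ (λ (j , _ , peak) → j , peak) (λ (j , peak , e) → j , <⇒≤ (<⇒≤ (proj₁ peak)) , peak , e)
       (anyUpTo? (λ j → peakAfter? f m j ×-dec (f (suc j) ≟ w)) m)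

peakAt-< : ∀ {f m k} → PeakAt f m k → suc k < m
peakAt-< {k = suc j} (j+2<m , _) = j+2<m

PeakAfter-cong : ∀ f g {m n j k} → suc (suc k) < n →
  f j ≡ g k → f (suc j) ≡ g (suc k) → f (suc (suc j)) ≡ g (suc (suc k)) →
  PeakAfter f m j → PeakAfter g n k
PeakAfter-cong f g k+2<n e₀ e₁ e₂ (_ , up , down) = k+2<n , subst₂ _<_ e₀ e₁ up , subst₂ _<_ e₂ e₁ down

-- Inserting and removing a largest value

record MaxInsertion (f g : ℕ → ℕ) (m i : ℕ) : Set where
  field
    i≤m   : i ≤ m
    left  : ∀ {k} → k < i → g k ≡ f k
    right : ∀ {k} → i ≤ k → k < m → g (suc k) ≡ f k
    top   : ∀ {k} → k < m → f k < g i

module _ {f g m i} (ins : MaxInsertion f g m i) where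
  open MaxInsertion ins

  private
    below-top-left : ∀ {k} → k < i → g k < g i
    below-top-left k<i = subst (_< g i) (sym (left k<i)) (top (<-≤-trans k<i i≤m))

    below-top-right : ∀ {k} → i ≤ k → k < m → g (suc k) < g i
    below-top-right i≤k k<m = subst (_< g i) (sym (right i≤k k<m)) (top k<m)

    removeMax-left : ∀ {j} → suc j < i → PeakAfter g (suc m) j → PeakValue f m (g (suc j))
    removeMax-left j+1<i peak@(_ , _ , down) with m≤n⇒m<n∨m≡n j+1<i
    ... | inj₂ refl  = contradiction down (<-asym (below-top-left ≤-refl))
    ... | inj₁ j+2<i =
      _ , PeakAfter-cong g f (<-≤-trans j+2<i i≤m) (left (<⇒≤ j+1<i)) (left j+1<i) (left j+2<i) peak ,
      sym (left j+1<i)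

    removeMax-right : ∀ {j} → i ≤ j → PeakAfter g (suc m) j → PeakValue f m (g (suc j))
    removeMax-right i≤j peak@(j+2<m+1 , up , _) with m≤n⇒m<n∨m≡n i≤j
    ... | inj₂ refl = contradiction up (<-asym (below-top-right ≤-refl (s<s⁻¹ (<⇒≤ j+2<m+1))))
    ... | inj₁ (s≤s i≤j′) =
      _ , PeakAfter-cong g f j′+2<m
            (right i≤j′ (<⇒≤ j′+1<m)) (right i≤j′+1 j′+1<m) (right i≤j′+2 j′+2<m) peak ,
      sym (right i≤j′+1 j′+1<m)
      where
      j′+2<m  = s<s⁻¹ j+2<m+1
      j′+1<m  = <⇒≤ j′+2<m
      i≤j′+1 = m≤n⇒m≤1+n i≤j′
      i≤j′+2 = m≤n⇒m≤1+n i≤j′+1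

    insertMax-left : ∀ {j} → ¬ PeakAt f m (pred i) → suc j < i → PeakAfter f m j → PeakValue g (suc m) (f (suc j))
    insertMax-left ¬peak-before j+1<i peak with m≤n⇒m<n∨m≡n j+1<i
    ... | inj₂ refl  = contradiction peak ¬peak-before
    ... | inj₁ j+2<i =
      _ , PeakAfter-cong f g (m<n⇒m<1+n (<-≤-trans j+2<i i≤m))
            (sym (left (<⇒≤ j+1<i))) (sym (left j+1<i)) (sym (left j+2<i)) peak ,
      left j+1<i

    insertMax-right : ∀ {j} → i ≤ j → PeakAfter f m j → PeakValue g (suc m) (f (suc j))
    insertMax-right i≤j peak@(j+2<m , _) =
      _ , PeakAfter-cong f g (s<s j+2<m)
            (sym (right i≤j (<⇒≤ j+1<m))) (sym (right i≤j+1 j+1<m)) (sym (right i≤j+2 j+2<m)) peak ,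
      right i≤j+1 j+1<m
      where
      j+1<m  = <⇒≤ j+2<m
      i≤j+1 = m≤n⇒m≤1+n i≤j
      i≤j+2 = m≤n⇒m≤1+n i≤j+1

  peakValue-removeMax : ∀ {w} → PeakValue g (suc m) w → PeakValue f m w ⊎ (w ≡ g i × i < m)
  peakValue-removeMax (j , peak , refl) with <-cmp i (suc j)
  ... | tri< i<j+1 _ _ = inj₁ (removeMax-right (s≤s⁻¹ i<j+1) peak)
  ... | tri≈ _ refl _  = inj₂ (refl , s<s⁻¹ (proj₁ peak))
  ... | tri> _ _ j+1<i = inj₁ (removeMax-left j+1<i peak)

  peakValue-insertMax : ¬ PeakAt f m i → ¬ PeakAt f m (pred i) →
                        ∀ {w} → PeakValue f m w → PeakValue g (suc m) w
  peakValue-insertMax ¬peak-i ¬peak-before (j , peak , refl) with <-cmp i (suc j)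
  ... | tri< i<j+1 _ _ = insertMax-right (s≤s⁻¹ i<j+1) peak
  ... | tri≈ _ refl _  = contradiction peak ¬peak-i
  ... | tri> _ _ j+1<i = insertMax-left ¬peak-before j+1<i peak

  peakValue-insertedMax : 0 < i → i < m → PeakValue g (suc m) (g i)
  peakValue-insertedMax (s≤s {n = j} z≤n) i<m =
    j , (s<s i<m , below-top-left ≤-refl , below-top-right ≤-refl i<m) , refl

toℕ-punchIn-< : ∀ {n} (i : Fin (suc n)) (j : Fin n) → toℕ j < toℕ i → toℕ (punchIn i j) ≡ toℕ j
toℕ-punchIn-< (Fin.suc i) Fin.zero    _         = refl
toℕ-punchIn-< (Fin.suc i) (Fin.suc j) (s<s j<i) = cong suc (toℕ-punchIn-< i j j<i)

toℕ-punchIn-≥ : ∀ {n} (i : Fin (suc n)) (j : Fin n) → toℕ i ≤ toℕ j → toℕ (punchIn i j) ≡ suc (toℕ j)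
toℕ-punchIn-≥ Fin.zero    j           _         = refl
toℕ-punchIn-≥ (Fin.suc i) (Fin.suc j) (s≤s i≤j) = cong suc (toℕ-punchIn-≥ i j i≤j)

maxInsertion : ∀ {n} (σ : Permutation′ (suc n)) (τ : Permutation′ n) (i : Fin (suc n)) →
               σ ⟨$⟩ʳ i ≡ fromℕ n → (∀ k → σ ⟨$⟩ʳ punchIn i k ≡ punchIn (fromℕ n) (τ ⟨$⟩ʳ k)) →
               MaxInsertion (entry τ) (entry σ) n (toℕ i)
maxInsertion {n} σ τ i σi≡max σ∘punchIn = record
  { i≤m   = i≤n
  ; left  = λ k<i → let k<n = <-≤-trans k<i i≤n in
      entry-punchIn k<n (trans (toℕ-punchIn-< i _ (subst (_< toℕ i) (sym (toℕ-fromℕ< k<n)) k<i))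
                               (toℕ-fromℕ< k<n))
  ; right = λ i≤k k<n →
      entry-punchIn k<n (trans (toℕ-punchIn-≥ i _ (subst (toℕ i ≤_) (sym (toℕ-fromℕ< k<n)) i≤k))
                               (cong suc (toℕ-fromℕ< k<n)))
  ; top   = λ k<n → subst (entry τ _ <_) (sym (entry-max σ σi≡max)) (entry< τ k<n)
  }
  where
  open ≡-Reasoning
  i≤n : toℕ i ≤ n
  i≤n = s≤s⁻¹ (toℕ<n i)
  entry-punchIn : ∀ {k l} (k<n : k < n) → toℕ (punchIn i (fromℕ< k<n)) ≡ l → entry σ l ≡ entry τ k
  entry-punchIn {k} {l} k<n e = begin
    entry σ l                                   ≡⟨ cong (entry σ) e ⟨
    entry σ (toℕ (punchIn i (fromℕ< k<n)))      ≡⟨ entry-toℕ σ _ ⟩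
    toℕ (σ ⟨$⟩ʳ punchIn i (fromℕ< k<n))         ≡⟨ cong toℕ (σ∘punchIn _) ⟩
    toℕ (punchIn (fromℕ n) (τ ⟨$⟩ʳ fromℕ< k<n)) ≡⟨ toℕ-punchIn-< (fromℕ n) _ below-max ⟩
    toℕ (τ ⟨$⟩ʳ fromℕ< k<n)                     ≡⟨ entry-fromℕ< τ k<n ⟨
    entry τ k                                   ∎
    where below-max = subst (toℕ (τ ⟨$⟩ʳ fromℕ< k<n) <_) (sym (toℕ-fromℕ n)) (toℕ<n _)

insertMax : ∀ {n} → Permutation′ n → Fin (suc n) → Permutation′ (suc n)
insertMax {n} σ i = insert i (fromℕ n) σ

insertMax-max : ∀ {n} (σ : Permutation′ n) i → insertMax σ i ⟨$⟩ʳ i ≡ fromℕ n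
insertMax-max σ i with i Fin.≟ i
... | yes _   = refl
... | no  i≢i = contradiction refl i≢i

insertMax-maxInsertion : ∀ {n} (σ : Permutation′ n) i → MaxInsertion (entry σ) (entry (insertMax σ i)) n (toℕ i)
insertMax-maxInsertion {n} σ i = maxInsertion (insertMax σ i) σ i (insertMax-max σ i) (insert-punchIn i (fromℕ n) σ)

removeMax : ∀ {n} → Permutation′ (suc n) → Permutation′ n
removeMax {n} σ = remove (σ ⟨$⟩ˡ fromℕ n) σ

removeMax-maxInsertion : ∀ {n} (σ : Permutation′ (suc n)) →
                         MaxInsertion (entry (removeMax σ)) (entry σ) n (toℕ (σ ⟨$⟩ˡ fromℕ n))
removeMax-maxInsertion {n} σ = maxInsertion σ (removeMax σ) _ (inverseʳ σ) (punchIn-permute′ σ (fromℕ n))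

-- Counting

χ : ∀ {A : Set} → Dec A → ℕ
χ (yes _) = 1
χ (no  _) = 0

χ-mono : ∀ {A B : Set} (a? : Dec A) (b? : Dec B) → (A → B) → χ a? ≤ χ b?
χ-mono (yes _) (yes _) _   = ≤-refl
χ-mono (yes a) (no ¬b) a⇒b = contradiction (a⇒b a) ¬b
χ-mono (no  _) _       _   = z≤n

χ-cong : ∀ {A B : Set} (a? : Dec A) (b? : Dec B) → A ⇔ B → χ a? ≡ χ b?
χ-cong a? b? a⇔b = ≤-antisym (χ-mono a? b? (Equivalence.to a⇔b)) (χ-mono b? a? (Equivalence.from a⇔b))

χ-yes : ∀ {A : Set} (a? : Dec A) → A → χ a? ≡ 1
χ-yes (yes _) _ = refl
χ-yes (no ¬a) a = contradiction a ¬a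

χ-no : ∀ {A : Set} (a? : Dec A) → ¬ A → χ a? ≡ 0
χ-no (yes a) ¬a = contradiction a ¬a
χ-no (no  _) _  = refl

count : ∀ {Q : ℕ → Set} → Decidable Q → ℕ → ℕ
count Q? zero    = 0
count Q? (suc k) = χ (Q? 0) + count (λ x → Q? (suc x)) k

count-mono : ∀ {P Q : ℕ → Set} (P? : Decidable P) (Q? : Decidable Q) k →
             (∀ {x} → x < k → P x → Q x) → count P? k ≤ count Q? k
count-mono P? Q? zero    _   = z≤n
count-mono P? Q? (suc k) P⇒Q =
  +-mono-≤ (χ-mono (P? 0) (Q? 0) (P⇒Q z<s)) (count-mono _ _ k (λ x<k → P⇒Q (s<s x<k)))

count-cong : ∀ {P Q : ℕ → Set} (P? : Decidable P) (Q? : Decidable Q) k →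
             (∀ {x} → x < k → P x → Q x) → (∀ {x} → x < k → Q x → P x) → count P? k ≡ count Q? k
count-cong P? Q? k P⇒Q Q⇒P = ≤-antisym (count-mono P? Q? k P⇒Q) (count-mono Q? P? k Q⇒P)

count-suc : ∀ {Q : ℕ → Set} (Q? : Decidable Q) k → count Q? (suc k) ≡ count Q? k + χ (Q? k)
count-suc Q? zero    = +-identityʳ (χ (Q? 0))
count-suc Q? (suc k) =
  trans (cong (χ (Q? 0) +_) (count-suc (λ x → Q? (suc x)) k)) (sym (+-assoc (χ (Q? 0)) _ _))

count-sum : ∀ {Q : ℕ → Set} (Q? : Decidable Q) m → count Q? m ≡ Σ.sum {m} (λ i → χ (Q? (toℕ i)))
count-sum Q? zero    = refl
count-sum Q? (suc m) = cong (χ (Q? 0) +_) (count-sum (λ x → Q? (suc x)) m)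

record Sparse (p : ℕ → Set) (m : ℕ) : Set where
  field
    ¬p0      : ¬ p 0
    p⇒<      : ∀ {k} → p k → k < m
    isolated : ∀ {k} → p k → ¬ p (suc k)

open Sparse

sparse-tail : ∀ {p m} → Sparse p (suc m) → ¬ p 1 → Sparse (λ x → p (suc x)) m
sparse-tail sp ¬p1 = record { ¬p0 = ¬p1 ; p⇒< = λ p → s<s⁻¹ (p⇒< sp p) ; isolated = isolated sp }

sparse-tail₂ : ∀ {p m} → Sparse p (suc (suc m)) → p 1 → Sparse (λ x → p (suc (suc x))) m
sparse-tail₂ sp p1 =
  record { ¬p0 = isolated sp p1 ; p⇒< = λ p → s<s⁻¹ (s<s⁻¹ (p⇒< sp p)) ; isolated = isolated sp }

sparse-count : ∀ {p} (p? : Decidable p) {m} → Sparse p m → 2 * count p? (suc m) ≤ m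
sparse-count-tail : ∀ {p} (p? : Decidable p) {m} → Sparse p m → 2 * count (λ x → p? (suc x)) m ≤ m

sparse-count p? sp rewrite χ-no (p? 0) (¬p0 sp) = sparse-count-tail p? sp

sparse-count-tail p? {zero}  sp = z≤n
sparse-count-tail p? {suc m} sp with p? 1
... | no ¬p1 = m≤n⇒m≤1+n (sparse-count-tail (λ x → p? (suc x)) (sparse-tail sp ¬p1))
... | yes p1 with m
...   | zero   = contradiction (p⇒< sp p1) (<-irrefl refl)
...   | suc m′ = subst (_≤ suc (suc m′)) (sym (*-suc 2 _))
                   (s≤s (s≤s (sparse-count (λ x → p? (suc (suc x))) (sparse-tail₂ sp p1))))

sparse-gap : ∀ {p} (p? : Decidable p) {m} → Sparse p m → 2 * count p? (suc m) < m →
             ∃[ k ] k < m × ¬ p k × ¬ p (suc k)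
sparse-gap-tail : ∀ {p} (p? : Decidable p) {m} → Sparse p m → 2 * count (λ x → p? (suc x)) m < m →
                  ∃[ k ] k < m × ¬ p k × ¬ p (suc k)

sparse-gap p? sp few rewrite χ-no (p? 0) (¬p0 sp) = sparse-gap-tail p? sp few

sparse-gap-tail p? {zero}  sp ()
sparse-gap-tail p? {suc m} sp few with p? 1
... | no ¬p1 = 0 , z<s , ¬p0 sp , ¬p1
... | yes p1 with m
...   | zero   = contradiction (p⇒< sp p1) (<-irrefl refl)
...   | suc m′ with sparse-gap (λ x → p? (suc (suc x))) (sparse-tail₂ sp p1)
                      (s<s⁻¹ (s<s⁻¹ (subst (_< suc (suc m′)) (*-suc 2 _) few)))
...     | k , k<m′ , ¬pk , ¬pk+1 = suc (suc k) , s<s (s<s k<m′) , ¬pk , ¬pk+1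

peakAt-sparse : ∀ f m → Sparse (PeakAt f (suc m)) m
peakAt-sparse f m = record
  { ¬p0      = λ ()
  ; p⇒<      = λ peak → s<s⁻¹ (peakAt-< peak)
  ; isolated = λ { {suc j} (_ , _ , down) (_ , up , _) → <-asym up down }
  }

peakAt⇒peakValue : ∀ f m {k} → PeakAt f m k → PeakValue f m (f k)
peakAt⇒peakValue f m {suc j} peak = j , peak , refl

peakValue-entry⇔peakAt : ∀ {m} (σ : Permutation′ m) {k} → k < m →
                         PeakValue (entry σ) m (entry σ k) ⇔ PeakAt (entry σ) m k
peakValue-entry⇔peakAt σ k<m = mk⇔
  (λ (j , peak , e) → subst (PeakAt (entry σ) _) (entry-injective σ (<⇒≤ (proj₁ peak)) k<m e) peak)
  (peakAt⇒peakValue (entry σ) _)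

count-peakValue≡count-peakAt : ∀ {m} (σ : Permutation′ m) →
                               count (peakValue? (entry σ) m) m ≡ count (peakAt? (entry σ) m) m
count-peakValue≡count-peakAt {m} σ = begin
  count (peakValue? f m) m                             ≡⟨ count-sum (peakValue? f m) m ⟩
  Σ.sum {m} (λ i → χ (peakValue? f m (toℕ i)))          ≡⟨ Σ.sum-permute (λ i → χ (peakValue? f m (toℕ i))) σ ⟩
  Σ.sum {m} (λ i → χ (peakValue? f m (toℕ (σ ⟨$⟩ʳ i)))) ≡⟨ Σ.sum-cong-≗ same-peaks ⟩
  Σ.sum {m} (λ i → χ (peakAt? f m (toℕ i)))             ≡⟨ count-sum (peakAt? f m) m ⟨
  count (peakAt? f m) m                                ∎
  where
  open ≡-Reasoning
  f = entry σ
  same-peaks : ∀ i → χ (peakValue? f m (toℕ (σ ⟨$⟩ʳ i))) ≡ χ (peakAt? f m (toℕ i))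
  same-peaks i = trans (cong (λ w → χ (peakValue? f m w)) (sym (entry-toℕ σ i)))
                       (χ-cong _ _ (peakValue-entry⇔peakAt σ (toℕ<n i)))

peakValues-count : ∀ {m} (σ : Permutation′ (suc m)) → 2 * count (peakValue? (entry σ) (suc m)) (suc m) ≤ m
peakValues-count {m} σ = subst (λ c → 2 * c ≤ m) (sym (count-peakValue≡count-peakAt σ))
                           (sparse-count (peakAt? (entry σ) (suc m)) (peakAt-sparse (entry σ) m))

-- Peak value sets of permutations

Admissible : ∀ {Q : ℕ → Set} → Decidable Q → Set
Admissible {Q} Q? = ∀ {v} → Q v → 2 * count Q? (suc v) ≤ v

admissible-⊆ : ∀ {P Q : ℕ → Set} (P? : Decidable P) (Q? : Decidable Q) →
               (∀ {w} → P w → Q w) → Admissible Q? → Admissible P?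
admissible-⊆ P? Q? P⊆Q adm {v} pv =
  ≤-trans (*-monoʳ-≤ 2 (count-mono P? Q? (suc v) (λ _ → P⊆Q))) (adm (P⊆Q pv))

peakValue-< : ∀ {m} (σ : Permutation′ m) {w} → PeakValue (entry σ) m w → w < m
peakValue-< σ (j , peak , refl) = entry< σ (<⇒≤ (proj₁ peak))

peakValues-admissible : ∀ n (σ : Permutation′ n) → Admissible (peakValue? (entry σ) n)
peakValues-admissible zero    σ (_ , (() , _) , _)
peakValues-admissible (suc n) σ {v} pv with v ≟ n
... | yes refl = peakValues-count σ
... | no v≢n = begin
  2 * count (peakValue? (entry σ) (suc n)) (suc v) ≤⟨ *-monoʳ-≤ 2 fewer-peaks ⟩
  2 * count (peakValue? (entry τ) n) (suc v)       ≤⟨ peakValues-admissible n τ (survives v≢n pv) ⟩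
  v                                                ∎
  where
  open ≤-Reasoning
  τ = removeMax σ
  survives : ∀ {w} → w ≢ n → PeakValue (entry σ) (suc n) w → PeakValue (entry τ) n w
  survives w≢n peak with peakValue-removeMax (removeMax-maxInsertion σ) peak
  ... | inj₁ peak′         = peak′
  ... | inj₂ (w≡max , _) = contradiction (trans w≡max (entry-max σ (inverseʳ σ))) w≢n
  v<n : v < n
  v<n = ≤∧≢⇒< (s≤s⁻¹ (peakValue-< σ pv)) v≢n
  fewer-peaks : count (peakValue? (entry σ) (suc n)) (suc v) ≤ count (peakValue? (entry τ) n) (suc v)
  fewer-peaks = count-mono (peakValue? (entry σ) (suc n)) (peakValue? (entry τ) n) (suc v)
                           (λ x≤v → survives (<⇒≢ (<-≤-trans x≤v v<n)))

HasPeakValues : ∀ {n} → Permutation′ n → (ℕ → Set) → Set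
HasPeakValues {n} σ Q = ∀ w → PeakValue (entry σ) n w ⇔ Q w

peakValues-appendMax : ∀ {n} (σ : Permutation′ n) → HasPeakValues (insertMax σ (fromℕ n)) (PeakValue (entry σ) n)
peakValues-appendMax {n} σ w = mk⇔ removed inserted
  where
  ins : MaxInsertion (entry σ) (entry (insertMax σ (fromℕ n))) n n
  ins = subst (MaxInsertion _ _ n) (toℕ-fromℕ n) (insertMax-maxInsertion σ (fromℕ n))
  removed : PeakValue (entry (insertMax σ (fromℕ n))) (suc n) w → PeakValue (entry σ) n w
  removed peak with peakValue-removeMax ins peak
  ... | inj₁ peak′     = peak′
  ... | inj₂ (_ , n<n) = contradiction n<n (<-irrefl refl)
  inserted : PeakValue (entry σ) n w → PeakValue (entry (insertMax σ (fromℕ n))) (suc n) w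
  inserted = peakValue-insertMax ins (λ peak → <-irrefl refl (<⇒≤ (peakAt-< peak)))
                                     (λ peak → <-irrefl refl (suc[m]≤n⇒m≤pred[n] (peakAt-< peak)))

peakValues-insertPeak : ∀ {n} (σ : Permutation′ n) → 2 * suc (count (peakAt? (entry σ) n) n) ≤ n →
                        Σ[ σ′ ∈ Permutation′ (suc n) ] HasPeakValues σ′ (λ w → PeakValue (entry σ) n w ⊎ w ≡ n)
peakValues-insertPeak {zero}  σ ()
peakValues-insertPeak {suc m} σ few
  with sparse-gap (peakAt? (entry σ) (suc m)) (peakAt-sparse (entry σ) m)
                  (s≤s⁻¹ (subst (_≤ suc m) (*-suc 2 _) few))
... | k , k<m , ¬peak-k , ¬peak-k+1 = insertMax σ i , λ w → mk⇔ removed inserted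
  where
  k+1<m+2 : suc k < suc (suc m)
  k+1<m+2 = s<s (m<n⇒m<1+n k<m)
  i = fromℕ< k+1<m+2
  toℕ-i : toℕ i ≡ suc k
  toℕ-i = toℕ-fromℕ< k+1<m+2
  ins : MaxInsertion (entry σ) (entry (insertMax σ i)) (suc m) (suc k)
  ins = subst (MaxInsertion _ _ _) toℕ-i (insertMax-maxInsertion σ i)
  new-top : entry (insertMax σ i) (suc k) ≡ suc m
  new-top = subst (λ l → entry (insertMax σ i) l ≡ suc m) toℕ-i
                  (entry-max (insertMax σ i) {i} (insertMax-max σ i))
  removed : ∀ {w} → PeakValue (entry (insertMax σ i)) (suc (suc m)) w →
            PeakValue (entry σ) (suc m) w ⊎ w ≡ suc m
  removed peak with peakValue-removeMax ins peak
  ... | inj₁ peak′       = inj₁ peak′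
  ... | inj₂ (w≡top , _) = inj₂ (trans w≡top new-top)
  inserted : ∀ {w} → PeakValue (entry σ) (suc m) w ⊎ w ≡ suc m →
             PeakValue (entry (insertMax σ i)) (suc (suc m)) w
  inserted (inj₁ peak) = peakValue-insertMax ins ¬peak-k+1 ¬peak-k peak
  inserted (inj₂ refl) = subst (PeakValue _ _) new-top (peakValue-insertedMax ins z<s (s<s k<m))

peakValues-adjoinMax : ∀ {n} {Q : ℕ → Set} (Q? : Decidable Q) → Admissible Q? → Q n →
                       (σ : Permutation′ n) → HasPeakValues σ (λ w → Q w × w ≢ n) →
                       Σ[ σ′ ∈ Permutation′ (suc n) ] HasPeakValues σ′ Q
peakValues-adjoinMax {n} {Q} Q? adm Qn σ realizes =
  let σ′ , realizes′ = peakValues-insertPeak σ few in σ′ , λ w → adjoin w ⇔-∘ realizes′ w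
  where
  peaks≡ : count (peakAt? (entry σ) n) n ≡ count Q? n
  peaks≡ = trans (sym (count-peakValue≡count-peakAt σ))
             (count-cong _ Q? n (λ _ p → proj₁ (Equivalence.to (realizes _) p))
                                (λ x<n q → Equivalence.from (realizes _) (q , <⇒≢ x<n)))
  count≡ : count Q? (suc n) ≡ suc (count (peakAt? (entry σ) n) n)
  count≡ = trans (count-suc Q? n) (trans (cong (count Q? n +_) (χ-yes (Q? n) Qn))
                                        (trans (+-comm _ 1) (cong suc (sym peaks≡))))
  few : 2 * suc (count (peakAt? (entry σ) n) n) ≤ n
  few = subst (λ c → 2 * c ≤ n) count≡ (adm Qn)
  adjoin : ∀ w → (PeakValue (entry σ) n w ⊎ w ≡ n) ⇔ Q w
  adjoin w = mk⇔ (λ { (inj₁ p) → proj₁ (Equivalence.to (realizes w) p) ; (inj₂ refl) → Qn }) back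
    where
    back : Q w → PeakValue (entry σ) n w ⊎ w ≡ n
    back q with w ≟ n
    ... | yes w≡n = inj₂ w≡n
    ... | no  w≢n = inj₁ (Equivalence.from (realizes w) (q , w≢n))

admissible⇒realizable : ∀ n {Q : ℕ → Set} (Q? : Decidable Q) → (∀ {v} → Q v → v < n) → Admissible Q? →
                        Σ[ σ ∈ Permutation′ n ] HasPeakValues σ Q
admissible⇒realizable zero    Q? Q⇒< _ =
  id , λ w → mk⇔ (λ { (_ , (() , _) , _) }) (λ q → contradiction (Q⇒< q) λ ())
admissible⇒realizable (suc n) {Q} Q? Q⇒< adm with Q? n
... | no ¬Qn =
  let σ , realizes = admissible⇒realizable n Q? (λ q → ≤∧≢⇒< (s≤s⁻¹ (Q⇒< q)) (λ { refl → ¬Qn q })) adm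
  in insertMax σ (fromℕ n) , λ w → realizes w ⇔-∘ peakValues-appendMax σ w
... | yes Qn =
  let σ , realizes = admissible⇒realizable n Q≢n? (λ (q , w≢n) → ≤∧≢⇒< (s≤s⁻¹ (Q⇒< q)) w≢n)
                                                 (admissible-⊆ Q≢n? Q? proj₁ adm)
  in peakValues-adjoinMax Q? adm Qn σ realizes
  where
  Q≢n? : Decidable (λ w → Q w × w ≢ n)
  Q≢n? w = Q? w ×-dec ¬? (w ≟ n)

-- Circular peak sets

lookupℕ : ∀ {m} → Subset m → ℕ → Bool
lookupℕ []      _       = false
lookupℕ (b ∷ S) zero    = b
lookupℕ (b ∷ S) (suc w) = lookupℕ S w

_∈ℕ_ : ∀ {m} → ℕ → Subset m → Set
w ∈ℕ S = lookupℕ S w ≡ true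

_∈ℕ?_ : ∀ {m} (w : ℕ) (S : Subset m) → Dec (w ∈ℕ S)
w ∈ℕ? S = lookupℕ S w B.≟ true

lookupℕ-toℕ : ∀ {m} (S : Subset m) (i : Fin m) → lookupℕ S (toℕ i) ≡ lookup S i
lookupℕ-toℕ (b ∷ S) Fin.zero    = refl
lookupℕ-toℕ (b ∷ S) (Fin.suc i) = lookupℕ-toℕ S i

∈⇔∈ℕ : ∀ {m} (S : Subset m) (i : Fin m) → i ∈ S ⇔ toℕ i ∈ℕ S
∈⇔∈ℕ S i = mk⇔ (λ i∈S → trans (lookupℕ-toℕ S i) ([]=⇒lookup i∈S))
                (λ i∈ℕS → lookup⇒[]= i S (trans (sym (lookupℕ-toℕ S i)) i∈ℕS))

∈ℕ⇒< : ∀ {m} (S : Subset m) {w} → w ∈ℕ S → w < m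
∈ℕ⇒< []      ()
∈ℕ⇒< (b ∷ S) {zero}  _    = z<s
∈ℕ⇒< (b ∷ S) {suc w} w∈S = s<s (∈ℕ⇒< S w∈S)

lookupℕ-∷ʳ-< : ∀ {m} (S : Subset m) b {w} → w < m → lookupℕ (S ∷ʳ b) w ≡ lookupℕ S w
lookupℕ-∷ʳ-< (x ∷ S) b {zero}  _         = refl
lookupℕ-∷ʳ-< (x ∷ S) b {suc w} (s<s w<m) = lookupℕ-∷ʳ-< S b w<m

lookupℕ-∷ʳ-last : ∀ {m} (S : Subset m) b → lookupℕ (S ∷ʳ b) m ≡ b
lookupℕ-∷ʳ-last []      b = refl
lookupℕ-∷ʳ-last (x ∷ S) b = lookupℕ-∷ʳ-last S b

∣∣≡count : ∀ {m} (S : Subset m) → ∣ S ∣ ≡ count (_∈ℕ? S) m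
∣∣≡count []          = refl
∣∣≡count (true  ∷ S) = cong suc (∣∣≡count S)
∣∣≡count (false ∷ S) = ∣∣≡count S

isPeakValue⇔peakValue : ∀ {m} (σ : Permutation′ m) (v : Fin m) → IsPeakValue σ v ⇔ PeakValue (entry σ) m (toℕ v)
isPeakValue⇔peakValue {m} σ v = mk⇔ to from
  where
  to : IsPeakValue σ v → PeakValue (entry σ) m (toℕ v)
  to (a , b , c , b≡1+a , c≡1+b , up , down , σb≡v) =
    toℕ a , (a+2<m , subst₂ _<_ (sym (entry-toℕ σ a)) (sym at-b) up , subst₂ _<_ (sym at-c) (sym at-b) down) ,
    trans at-b (cong toℕ σb≡v)
    where
    a+2≡c : suc (suc (toℕ a)) ≡ toℕ c
    a+2≡c = trans (cong suc (sym b≡1+a)) (sym c≡1+b)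
    a+2<m : suc (suc (toℕ a)) < m
    a+2<m = subst (_< m) (sym a+2≡c) (toℕ<n c)
    at-b : entry σ (suc (toℕ a)) ≡ toℕ (σ ⟨$⟩ʳ b)
    at-b = trans (cong (entry σ) (sym b≡1+a)) (entry-toℕ σ b)
    at-c : entry σ (suc (suc (toℕ a))) ≡ toℕ (σ ⟨$⟩ʳ c)
    at-c = trans (cong (entry σ) a+2≡c) (entry-toℕ σ c)
  from : PeakValue (entry σ) m (toℕ v) → IsPeakValue σ v
  from (j , (j+2<m , up , down) , e) =
    fromℕ< j<m , fromℕ< j+1<m , fromℕ< j+2<m ,
    trans (toℕ-fromℕ< j+1<m) (cong suc (sym (toℕ-fromℕ< j<m))) ,
    trans (toℕ-fromℕ< j+2<m) (cong suc (sym (toℕ-fromℕ< j+1<m))) ,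
    subst₂ _<_ (entry-fromℕ< σ j<m) (entry-fromℕ< σ j+1<m) up ,
    subst₂ _<_ (entry-fromℕ< σ j+2<m) (entry-fromℕ< σ j+1<m) down ,
    toℕ-injective (trans (sym (entry-fromℕ< σ j+1<m)) e)
    where
    j+1<m = <⇒≤ j+2<m
    j<m   = <⇒≤ j+1<m

toℕ-⇔-extend : ∀ {m} {P Q : ℕ → Set} → (∀ {w} → P w → w < m) → (∀ {w} → Q w → w < m) →
               (∀ (v : Fin m) → P (toℕ v) ⇔ Q (toℕ v)) → ∀ w → P w ⇔ Q w
toℕ-⇔-extend {m} {P} {Q} P⇒< Q⇒< P⇔Q w with w <? m
... | yes w<m = subst (λ x → P x ⇔ Q x) (toℕ-fromℕ< w<m) (P⇔Q (fromℕ< w<m))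
... | no  w≮m = mk⇔ (λ p → contradiction (P⇒< p) w≮m) (λ q → contradiction (Q⇒< q) w≮m)

CPIs⇔HasPeakValues : ∀ {m} (σ : Permutation′ m) (S : Subset m) → CPIs σ S ⇔ HasPeakValues σ (_∈ℕ S)
CPIs⇔HasPeakValues σ S = mk⇔
  (λ cp → toℕ-⇔-extend (peakValue-< σ) (∈ℕ⇒< S)
            (λ v → (∈⇔∈ℕ S v ⇔-∘ ⇔-sym (cp v)) ⇔-∘ ⇔-sym (isPeakValue⇔peakValue σ v)))
  (λ realizes v → (⇔-sym (isPeakValue⇔peakValue σ v) ⇔-∘ ⇔-sym (realizes (toℕ v))) ⇔-∘ ∈⇔∈ℕ S v)

IsCircularPeakSet : ∀ {m} → Subset m → Set
IsCircularPeakSet S = ∃[ σ ] CPIs σ S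

circularPeakSet⇔admissible : ∀ {m} (S : Subset m) → IsCircularPeakSet S ⇔ Admissible (_∈ℕ? S)
circularPeakSet⇔admissible {m} S = mk⇔ necessary sufficient
  where
  necessary : IsCircularPeakSet S → Admissible (_∈ℕ? S)
  necessary (σ , cp) = admissible-⊆ (_∈ℕ? S) (peakValue? (entry σ) m)
                         (Equivalence.from (Equivalence.to (CPIs⇔HasPeakValues σ S) cp _))
                         (peakValues-admissible m σ)
  sufficient : Admissible (_∈ℕ? S) → IsCircularPeakSet S
  sufficient adm = let σ , realizes = admissible⇒realizable m (_∈ℕ? S) (∈ℕ⇒< S) adm
                   in σ , Equivalence.from (CPIs⇔HasPeakValues σ S) realizes

circularPeakSet-size : ∀ {m} (S : Subset (suc m)) → IsCircularPeakSet S → 2 * ∣ S ∣ ≤ m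
circularPeakSet-size {m} S (σ , cp) = subst (λ c → 2 * c ≤ m) (sym ∣S∣≡) (peakValues-count σ)
  where
  realizes = Equivalence.to (CPIs⇔HasPeakValues σ S) cp
  ∣S∣≡ : ∣ S ∣ ≡ count (peakValue? (entry σ) (suc m)) (suc m)
  ∣S∣≡ = trans (∣∣≡count S) (count-cong (_∈ℕ? S) (peakValue? (entry σ) (suc m)) (suc m)
                                        (λ _ → Equivalence.from (realizes _)) (λ _ → Equivalence.to (realizes _)))

count-∷ʳ : ∀ {m} (S : Subset m) b {k} → k ≤ m → count (_∈ℕ? (S ∷ʳ b)) k ≡ count (_∈ℕ? S) k
count-∷ʳ S b k≤m = count-cong (_∈ℕ? (S ∷ʳ b)) (_∈ℕ? S) _
  (λ x<k → trans (sym (lookupℕ-∷ʳ-< S b (<-≤-trans x<k k≤m))))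
  (λ x<k → trans (lookupℕ-∷ʳ-< S b (<-≤-trans x<k k≤m)))

count-∷ʳ-last : ∀ {m} (S : Subset m) {b} → b ≡ true → count (_∈ℕ? (S ∷ʳ b)) (suc m) ≡ suc ∣ S ∣
count-∷ʳ-last {m} S {b} b≡true = begin
  count (_∈ℕ? (S ∷ʳ b)) (suc m)                ≡⟨ count-suc (_∈ℕ? (S ∷ʳ b)) m ⟩
  count (_∈ℕ? (S ∷ʳ b)) m + χ (m ∈ℕ? (S ∷ʳ b)) ≡⟨ cong₂ _+_ (count-∷ʳ S b ≤-refl) (χ-yes _ m∈S∷ʳb) ⟩
  count (_∈ℕ? S) m + 1                        ≡⟨ cong (_+ 1) (∣∣≡count S) ⟨
  ∣ S ∣ + 1                                   ≡⟨ +-comm ∣ S ∣ 1 ⟩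
  suc ∣ S ∣                                   ∎
  where
  open ≡-Reasoning
  m∈S∷ʳb = trans (lookupℕ-∷ʳ-last S b) b≡true

admissible-∷ʳ⇔ : ∀ {m} (S : Subset m) b →
                 Admissible (_∈ℕ? (S ∷ʳ b)) ⇔ (Admissible (_∈ℕ? S) × (b ≡ true → 2 * suc ∣ S ∣ ≤ m))
admissible-∷ʳ⇔ {m} S b = mk⇔ restrict extend
  where
  restrict : Admissible (_∈ℕ? (S ∷ʳ b)) → Admissible (_∈ℕ? S) × (b ≡ true → 2 * suc ∣ S ∣ ≤ m)
  restrict adm =
    admissible-⊆ (_∈ℕ? S) (_∈ℕ? (S ∷ʳ b)) (λ w∈S → trans (lookupℕ-∷ʳ-< S b (∈ℕ⇒< S w∈S)) w∈S) adm ,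
    λ b≡true → subst (_≤ m) (cong (2 *_) (count-∷ʳ-last S b≡true))
                     (adm (trans (lookupℕ-∷ʳ-last S b) b≡true))
  extend : Admissible (_∈ℕ? S) × (b ≡ true → 2 * suc ∣ S ∣ ≤ m) → Admissible (_∈ℕ? (S ∷ʳ b))
  extend (adm , top-ok) {v} v∈ with m≤n⇒m<n∨m≡n (s≤s⁻¹ (∈ℕ⇒< (S ∷ʳ b) v∈))
  ... | inj₁ v<m  = subst (_≤ v) (cong (2 *_) (sym (count-∷ʳ S b v<m)))
                          (adm (trans (sym (lookupℕ-∷ʳ-< S b v<m)) v∈))
  ... | inj₂ refl = subst (_≤ m) (cong (2 *_) (sym (count-∷ʳ-last S b≡true))) (top-ok b≡true)
    where b≡true = trans (sym (lookupℕ-∷ʳ-last S b)) v∈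

circularPeakSet-∷ʳ⇔ : ∀ {m} (S : Subset m) b →
                      IsCircularPeakSet (S ∷ʳ b) ⇔ (IsCircularPeakSet S × (b ≡ true → 2 * suc ∣ S ∣ ≤ m))
circularPeakSet-∷ʳ⇔ S b =
  ((⇔-sym (circularPeakSet⇔admissible S) ×-⇔ ⇔-id _) ⇔-∘ admissible-∷ʳ⇔ S b)
    ⇔-∘ circularPeakSet⇔admissible (S ∷ʳ b)

-- 𝒫_{n+1} versus 𝟐 × 𝒫_n

head-≤ : ∀ {m} {s t} {p q : Subset m} → s ∷ p ⊆ t ∷ q → s B.≤ t
head-≤ {s = false} {false} _ = B.b≤b
head-≤ {s = false} {true}  _ = B.f≤t
head-≤ {s = true}  sub with sub here
... | here = B.b≤b

∷-⊆ : ∀ {m} {s t} {p q : Subset m} → s B.≤ t → p ⊆ q → s ∷ p ⊆ t ∷ q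
∷-⊆ B.b≤b = s⊆s
∷-⊆ B.f≤t = out⊆

∷ʳ-⊆⇔ : ∀ {m} (p q : Subset m) s t → (p ∷ʳ s ⊆ q ∷ʳ t) ⇔ (s B.≤ t × p ⊆ q)
∷ʳ-⊆⇔ p q s t = mk⇔ (to p q) (uncurry (from p q))
  where
  to : ∀ {m} (p q : Subset m) → p ∷ʳ s ⊆ q ∷ʳ t → s B.≤ t × p ⊆ q
  to []      []      sub = head-≤ sub , λ ()
  to (x ∷ p) (y ∷ q) sub = let s≤t , p⊆q = to p q (drop-∷-⊆ sub) in s≤t , ∷-⊆ (head-≤ sub) p⊆q
  from : ∀ {m} (p q : Subset m) → s B.≤ t → p ⊆ q → p ∷ʳ s ⊆ q ∷ʳ t
  from []      []      s≤t _   = ∷-⊆ s≤t (λ ())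
  from (x ∷ p) (y ∷ q) s≤t sub = ∷-⊆ (head-≤ sub) (from p q s≤t (drop-∷-⊆ sub))

∷ʳ-init-last : ∀ {m} (S : Subset (suc m)) → init S ∷ʳ last S ≡ S
∷ʳ-init-last S = sym (proj₂ (proj₂ (initLast S)))

⊆⇔init-last : ∀ {m} (S S′ : Subset (suc m)) → S ⊆ S′ ⇔ (last S B.≤ last S′ × init S ⊆ init S′)
⊆⇔init-last S S′ = subst₂ (λ X Y → X ⊆ Y ⇔ (last S B.≤ last S′ × init S ⊆ init S′))
                           (∷ʳ-init-last S) (∷ʳ-init-last S′) (∷ʳ-⊆⇔ (init S) (init S′) (last S) (last S′))

Extendable : ∀ {n} → TwoP n → Set
Extendable {n} (b , T , _) = b ≡ true → 2 * suc ∣ T ∣ ≤ n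

split : ∀ {n} → P (suc n) → Σ (TwoP n) Extendable
split (S , S-peaks) =
  let T-peaks , extendable = Equivalence.to (circularPeakSet-∷ʳ⇔ (init S) (last S))
                                            (subst IsCircularPeakSet (sym (∷ʳ-init-last S)) S-peaks)
  in (last S , init S , T-peaks) , extendable

glue : ∀ {n} → Σ (TwoP n) Extendable → P (suc n)
glue ((b , T , T-peaks) , extendable) = T ∷ʳ b , Equivalence.from (circularPeakSet-∷ʳ⇔ T b) (T-peaks , extendable)

glue-split : ∀ {n} (x : P (suc n)) → glue (split x) ≈P x
glue-split (S , _) = ∷ʳ-init-last S

split-glue : ∀ {n} (p : Σ (TwoP n) Extendable) → proj₁ (split (glue p)) ≈2P proj₁ p
split-glue ((b , T , _) , _) = last-∷ʳ b T , init-∷ʳ b T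

split-order : ∀ {n} (x y : P (suc n)) → (x ≤P y) ⇔ (proj₁ (split x) ≤2P proj₁ (split y))
split-order (S , _) (S′ , _) = ⊆⇔init-last S S′

extendable-even : ∀ {m} → 2 ∣ suc m → (p : TwoP (suc m)) → Extendable p
extendable-even {m} (divides q 1+m≡q*2) (b , T , T-peaks) _ =
  subst (_≤ suc m) (sym (*-suc 2 ∣ T ∣)) (s≤s (≤∧≢⇒< (circularPeakSet-size T T-peaks) 2∣T∣≢m))
  where
  2∣T∣≢m : 2 * ∣ T ∣ ≢ m
  2∣T∣≢m 2∣T∣≡m = even≢odd q ∣ T ∣ (trans (*-comm 2 q) (trans (sym 1+m≡q*2) (cong suc (sym 2∣T∣≡m))))

extendable-odd⇔ : ∀ t (p : TwoP (suc (2 * t))) →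
                  Extendable p ⇔ (¬ (proj₁ p ≡ true × ∣ proj₁ (proj₂ p) ∣ ≡ t))
extendable-odd⇔ t (b , T , T-peaks) = mk⇔
  (λ extendable (b≡true , ∣T∣≡t) →
     <-irrefl refl (subst (λ c → c ≤ suc (2 * t)) (trans (cong (λ c → 2 * suc c) ∣T∣≡t) (*-suc 2 t))
                          (extendable b≡true)))
  (λ not-removed b≡true →
     subst (_≤ suc (2 * t)) (sym (*-suc 2 ∣ T ∣))
       (s≤s (≤∧≢⇒< (circularPeakSet-size T T-peaks)
                    (λ 2∣T∣≡2t → not-removed (b≡true , *-cancelˡ-≡ ∣ T ∣ t 2 2∣T∣≡2t)))))

evenIso : ∀ {m} → 2 ∣ suc m → PosetIso {P (suc (suc m))} {TwoP (suc m)} _≈P_ _≤P_ _≈2P_ _≤2P_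
evenIso 2∣1+m = record
  { to      = λ x → proj₁ (split x)
  ; from    = λ p → glue (p , extendable-even 2∣1+m p)
  ; from-to = glue-split
  ; to-from = λ p → split-glue (p , extendable-even 2∣1+m p)
  ; order   = split-order
  }

oddIso : ∀ t r → r + 1 ≡ t →
         PosetIso {P (suc (suc (2 * t)))} {TwoPMinus (suc (2 * t)) r} _≈P_ _≤P_ _≈2PM_ _≤2PM_
oddIso t r r+1≡t = record
  { to      = λ x → proj₁ (split x) , Equivalence.to (kept⇔ (proj₁ (split x))) (proj₂ (split x))
  ; from    = λ (p , kept) → glue (p , Equivalence.from (kept⇔ p) kept)
  ; from-to = glue-split
  ; to-from = λ (p , kept) → split-glue (p , Equivalence.from (kept⇔ p) kept)
  ; order   = split-order
  }
  where
  kept⇔ : (p : TwoP (suc (2 * t))) → Extendable p ⇔ (¬ (proj₁ p ≡ true × InPni r (proj₂ p)))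
  kept⇔ p = subst (λ k → Extendable p ⇔ (¬ (proj₁ p ≡ true × ∣ proj₁ (proj₂ p) ∣ ≡ k)))
                  (sym r+1≡t) (extendable-odd⇔ t p)

⌊2*n/2⌋≡n : ∀ n → ⌊ 2 * n /2⌋ ≡ n
⌊2*n/2⌋≡n zero    = refl
⌊2*n/2⌋≡n (suc n) = trans (cong ⌊_/2⌋ (*-suc 2 n)) (cong suc (⌊2*n/2⌋≡n n))

odd⇒suc-double : ∀ n → ¬ 2 ∣ n → ∃[ t ] n ≡ suc (2 * t)
odd⇒suc-double zero          ¬2∣0   = contradiction (2 ∣0) ¬2∣0
odd⇒suc-double (suc zero)    _      = 0 , refl
odd⇒suc-double (suc (suc n)) ¬2∣2+n =
  let t , n≡1+2t = odd⇒suc-double n (λ 2∣n → ¬2∣2+n (∣m∣n⇒∣m+n ∣-refl 2∣n))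
  in suc t , trans (cong (2 +_) n≡1+2t) (cong suc (sym (*-suc 2 t)))

theorem3p3 : (n : ℕ) → 3 ≤ n →
    ((2 ∣ n) → PosetIso {P (suc n)} {TwoP n} _≈P_ _≤P_ _≈2P_ _≤2P_)
    × ((¬ (2 ∣ n)) → PosetIso {P (suc n)} {TwoPMinus n (removedRank n)} _≈P_ _≤P_ _≈2PM_ _≤2PM_)
theorem3p3 zero    ()
theorem3p3 (suc m) 3≤1+m = evenIso , oddCase
  where
  oddCase : ¬ 2 ∣ suc m →
            PosetIso {P (suc (suc m))} {TwoPMinus (suc m) (removedRank (suc m))} _≈P_ _≤P_ _≈2PM_ _≤2PM_
  oddCase ¬2∣1+m with odd⇒suc-double (suc m) ¬2∣1+m
  ... | t , refl = oddIso t (removedRank (suc (2 * t))) rank+1≡t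
    where
    rank+1≡t : removedRank (suc (2 * t)) + 1 ≡ t
    rank+1≡t = trans (cong (λ h → h ∸ 1 + 1) (⌊2*n/2⌋≡n t))
                     (m∸n+n≡m {t} {1} (*-cancelˡ-≤ 2 (s≤s⁻¹ 3≤1+m)))
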